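{- Let $n\ge8$ and let $\mathcal{Z}\subseteq\{1,\dots,N\}$ be a set such that for all $m,\ell\in\mathcal{Z}$ and all $\delta\in\{ -1,0,1\}$ one has $\frac{n+1-\epsilon(n)}{2}\not\equiv 2(m-\ell)+\delta \pmod n$. Then $\mathfrak{B}_\ell\cap\mathfrak{B}_{\ell'}=\emptyset$ for any distinct $\ell,\ell'\in\mathcal{Z}$.
   Context: For $1 \le i,j \le n$ let $\mathbf{c}_{i,j} \in \mathbb{R}^{2n+1}$ be the vector whose $k$-th coordinate ($1\le k\le n$) is $1$ if $k=i$ and $0$ otherwise, whose $(n+k)$-th coordinate ($1 \le k \le n-1$) is $1$ if $k=j$ and $0$ otherwise, whose $2n$-th coordinate is $1$ if $i=j$ and $0$ otherwise, and whose $(2n+1)$-th coordinate is $1$ if $i+j=n+1$ and $0$ otherwise. The second subscript is read modulo $n$: $\mathbf{c}_{i,j+mn}=\mathbf{c}_{i,j}$. Let $\epsilon(n)=1$ if $n$ is even and $0$ if $n$ is odd, and $N=\frac{n-1+\epsilon(n)}{2}-2$. For $0\le\ell\le N$ let $\widetilde{\mathfrak{B}}_\ell=\{\mathbf{c}_{i,i+2\ell}:1\le i\le n\}\cup(\{\mathbf{c}_{i,i+2\ell+1}:1\le i\le n\}\setminus\{\mathbf{c}_{n-2\ell-1,n}\})$. For $1\le\ell\le N$ let $i_1=i_1(\ell)=\frac{n+1-\epsilon(n)}{2}-\ell$, $i_2=i_2(\ell)=n-\ell$, and $$\mathfrak{B}_\ell=\Big(\widetilde{\mathfrak{B}}_\ell\setminus\{\mathbf{c}_{i_1,i_1+2\ell},\mathbf{c}_{i_1,i_1+2\ell+1},\mathbf{c}_{i_2,i_2+2\ell},\mathbf{c}_{i_2,i_2+2\ell+1}\}\Big)\cup\{\mathbf{c}_{i_1,i_2+2\ell},\mathbf{c}_{i_1,i_2+2\ell+1},\mathbf{c}_{i_2,i_1+2\ell},\mathbf{c}_{i_2,i_1+2\ell+1}\}.$$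 -}

module Defs where

open import Data.Nat using (ℕ; zero; suc; _+_; _*_; _∸_; _≤_; _≟_; _≤?_; NonZero)
open import Data.Nat.DivMod using (_/_; _%_)
open import Data.Bool using (Bool; true; false; if_then_else_)
open import Data.Fin using (Fin; toℕ)
open import Data.Vec using (Vec; tabulate)
open import Data.Integer as ℤ using (ℤ; +_)
open import Data.Integer.Divisibility using () renaming (_∣_ to _∣ℤ_)
open import Data.Product using (Σ; ∃; _×_; _,_)
open import Data.Sum using (_⊎_)
open import Relation.Nullary using (¬_)
open import Relation.Nullary.Decidable using (⌊_⌋)
open import Relation.Binary.PropositionalEquality using (_≡_; _≢_)

ε : ℕ → ℕ
ε zero = 1
ε (suc zero) = 0
ε (suc (suc n)) = ε n

bigN : ℕ → ℕ
bigN n = ((n ∸ 1 + ε n) / 2) ∸ 2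

ind : Bool → ℕ
ind b = if b then 1 else 0

normJ : (n : ℕ) → .{{NonZero n}} → ℕ → ℕ
normJ n j = suc ((j ∸ 1) % n)

-- k-th coordinate (k counted from 1) of c_{i,j}, where j is already in {1,…,n}
coord : ℕ → ℕ → ℕ → ℕ → ℕ
coord n i j k =
  if ⌊ k ≤? n ⌋ then ind ⌊ k ≟ i ⌋
  else if ⌊ k ≤? (2 * n ∸ 1) ⌋ then ind ⌊ k ∸ n ≟ j ⌋
  else if ⌊ k ≟ 2 * n ⌋ then ind ⌊ i ≟ j ⌋
  else ind ⌊ i + j ≟ n + 1 ⌋

-- the vector c_{i,j} ∈ ℝ^{2n+1} (all coordinates are 0/1, stored in ℕ);
-- second subscript read modulo n
c : (n : ℕ) → .{{NonZero n}} → ℕ → ℕ → Vec ℕ (2 * n + 1)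
c n i j = tabulate (λ (k : Fin (2 * n + 1)) → coord n i (normJ n j) (suc (toℕ k)))

InBt : (n : ℕ) → .{{NonZero n}} → ℕ → Vec ℕ (2 * n + 1) → Set
InBt n ℓ v =
  (∃ λ i → (1 ≤ i × i ≤ n) × v ≡ c n i (i + 2 * ℓ))
  ⊎ ((∃ λ i → (1 ≤ i × i ≤ n) × v ≡ c n i (i + 2 * ℓ + 1))
     × v ≢ c n (n ∸ 2 * ℓ ∸ 1) n)

i₁ : ℕ → ℕ → ℕ
i₁ n ℓ = ((n + 1 ∸ ε n) / 2) ∸ ℓ

i₂ : ℕ → ℕ → ℕ
i₂ n ℓ = n ∸ ℓ

InB : (n : ℕ) → .{{NonZero n}} → ℕ → Vec ℕ (2 * n + 1) → Set
InB n ℓ v =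
  (InBt n ℓ v
    × v ≢ c n a (a + 2 * ℓ)
    × v ≢ c n a (a + 2 * ℓ + 1)
    × v ≢ c n b (b + 2 * ℓ)
    × v ≢ c n b (b + 2 * ℓ + 1))
  ⊎ (v ≡ c n a (b + 2 * ℓ)
    ⊎ v ≡ c n a (b + 2 * ℓ + 1)
    ⊎ v ≡ c n b (a + 2 * ℓ)
    ⊎ v ≡ c n b (a + 2 * ℓ + 1))
  where
  a = i₁ n ℓ
  b = i₂ n ℓ

_≡_[mod_] : ℤ → ℤ → ℕ → Set
x ≡ y [mod n ] = (+ n) ∣ℤ (x ℤ.- y)

Admissible : ℕ → (ℕ → Set) → Set
Admissible n Z =
  (∀ m → Z m → 1 ≤ m × m ≤ bigN n)
  × (∀ m ℓ (δ : ℤ) → Z m → Z ℓ →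
       (δ ≡ ℤ.- (+ 1) ⊎ δ ≡ + 0 ⊎ δ ≡ + 1) →
       ¬ ((+ ((n + 1 ∸ ε n) / 2)) ≡ (+ 2) ℤ.* ((+ m) ℤ.- (+ ℓ)) ℤ.+ δ [mod n ]))

{-# OPTIONS --safe #-}
-- Every element of 𝔅_ℓ is a vector c_{i,j} whose offset j − i is 2ℓ + δ with δ ∈ {0,1}, except in
-- the two swapped rows i₁ < i₂, where the offset is shifted by ±(i₂ − i₁) = ±(n − ⌈n/2⌉), i.e. by
-- ∓⌈n/2⌉ modulo n (note (n + 1 − ε(n))/2 = ⌈n/2⌉ and N = ⌊n/2⌋ − 2). Since c_{i,j} determines i
-- and j mod n, a common element of 𝔅_ℓ and 𝔅_ℓ′ gives two offsets in the same row congruent mod n.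
-- Two offsets shifted alike reduce to 2ℓ + δ ≡ 2ℓ′ + δ′ with both sides below n, whence ℓ = ℓ′ by
-- parity; an unshifted offset congruent to a shifted one means ⌈n/2⌉ ≡ 2(ℓ′ − ℓ) + (δ′ − δ)
-- (mod n) up to exchanging ℓ and ℓ′, which the hypothesis on 𝒵 excludes; and rows shifted in
-- opposite directions never coincide, because i₁(ℓ) < i₂(ℓ′).
module Submission where

open import Defs
open import Data.Nat using (ℕ; zero; suc; _+_; _*_; _∸_; _≤_; _<_; z≤n; s≤s; NonZero; _≟_; _≤?_; _⊔_; ⌊_/2⌋; ⌈_/2⌉)
open import Data.Nat.Properties
open import Data.Nat.DivMod using (_/_; m/n≡1+[m∸n]/n; m≡m%n+[m/n]*n; m%n<n)
open import Data.Nat.Divisibility using (>⇒∤) renaming (_∣_ to _∣ℕ_)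
open import Data.Integer as ℤ using (ℤ; +_)
import Data.Integer.Properties as ℤ
open import Data.Integer.Divisibility.Signed using (_∣_; divides; ∣-refl; ∣⇒∣ᵤ; ∣m⇒∣-m; ∣m+n∣n⇒∣m)
open import Data.Integer.Tactic.RingSolver using (solve-∀)
open import Data.Fin using (fromℕ<)
open import Data.Fin.Properties using (toℕ-fromℕ<)
open import Data.Vec using (Vec; lookup)
open import Data.Vec.Properties using (lookup∘tabulate)
open import Data.Product using (∃₂; _×_; _,_; proj₁; proj₂)
open import Data.Sum using (_⊎_; inj₁; inj₂)
open import Data.Empty using (⊥-elim)
open import Relation.Nullary using (¬_; yes; no; contradiction)
open import Relation.Nullary.Decidable using (⌊_⌋)
open import Relation.Binary.PropositionalEquality hiding (J)

[2+m]/2≡1+m/2 : ∀ m → (2 + m) / 2 ≡ suc (m / 2)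
[2+m]/2≡1+m/2 m = m/n≡1+[m∸n]/n {2 + m} {2} (s≤s (s≤s z≤n))

ε≤1 : ∀ n → ε n ≤ 1
ε≤1 zero = s≤s z≤n
ε≤1 (suc zero) = z≤n
ε≤1 (suc (suc n)) = ε≤1 n

[n+1∸εn]/2≡⌈n/2⌉ : ∀ n → (n + 1 ∸ ε n) / 2 ≡ ⌈ n /2⌉
[n+1∸εn]/2≡⌈n/2⌉ zero = refl
[n+1∸εn]/2≡⌈n/2⌉ (suc zero) = refl
[n+1∸εn]/2≡⌈n/2⌉ (suc (suc n)) = begin
  (2 + (n + 1) ∸ ε n) / 2  ≡⟨ cong (_/ 2) (+-∸-assoc 2 (≤-trans (ε≤1 n) (m≤n+m 1 n))) ⟩
  (2 + (n + 1 ∸ ε n)) / 2  ≡⟨ [2+m]/2≡1+m/2 (n + 1 ∸ ε n) ⟩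
  suc ((n + 1 ∸ ε n) / 2)  ≡⟨ cong suc ([n+1∸εn]/2≡⌈n/2⌉ n) ⟩
  suc ⌈ n /2⌉              ∎
  where open ≡-Reasoning

[n∸1+εn]/2≡⌊n/2⌋ : ∀ n → (n ∸ 1 + ε n) / 2 ≡ ⌊ n /2⌋
[n∸1+εn]/2≡⌊n/2⌋ zero = refl
[n∸1+εn]/2≡⌊n/2⌋ (suc zero) = refl
[n∸1+εn]/2≡⌊n/2⌋ (suc (suc zero)) = refl
[n∸1+εn]/2≡⌊n/2⌋ (suc (suc (suc n))) =
  trans ([2+m]/2≡1+m/2 (n + ε (suc n))) (cong suc ([n∸1+εn]/2≡⌊n/2⌋ (suc n)))

i₁≡⌈n/2⌉∸ℓ : ∀ n ℓ → i₁ n ℓ ≡ ⌈ n /2⌉ ∸ ℓ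
i₁≡⌈n/2⌉∸ℓ n ℓ = cong (_∸ ℓ) ([n+1∸εn]/2≡⌈n/2⌉ n)

≤bigN⇒<⌊n/2⌋ : ∀ n {m} → 1 ≤ m → m ≤ bigN n → m < ⌊ n /2⌋
≤bigN⇒<⌊n/2⌋ n {m} 1≤m m≤N = begin-strict
  m              ≤⟨ m≤f∸2 ⟩
  ⌊ n /2⌋ ∸ 2    <⟨ ∸-monoʳ-< (s≤s z≤n) (<⇒≤ 2<f) ⟩
  ⌊ n /2⌋        ∎
  where
  open ≤-Reasoning
  m≤f∸2 : m ≤ ⌊ n /2⌋ ∸ 2
  m≤f∸2 = subst (m ≤_) (cong (_∸ 2) ([n∸1+εn]/2≡⌊n/2⌋ n)) m≤N
  2<f : 2 < ⌊ n /2⌋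
  2<f = m∸n≢0⇒n<m (m<n⇒n≢0 (≤-trans 1≤m m≤f∸2))

<⌊n/2⌋⇒<⌈n/2⌉ : ∀ {m n} → m < ⌊ n /2⌋ → m < ⌈ n /2⌉
<⌊n/2⌋⇒<⌈n/2⌉ {n = n} m<f = <-≤-trans m<f (⌊n/2⌋≤⌈n/2⌉ n)

<⌊n/2⌋⇒⌈n/2⌉+m<n : ∀ {m n} → m < ⌊ n /2⌋ → ⌈ n /2⌉ + m < n
<⌊n/2⌋⇒⌈n/2⌉+m<n {m} {n} m<f = begin-strict
  ⌈ n /2⌉ + m        <⟨ +-monoʳ-< ⌈ n /2⌉ m<f ⟩
  ⌈ n /2⌉ + ⌊ n /2⌋  ≡⟨ +-comm ⌈ n /2⌉ ⌊ n /2⌋ ⟩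
  ⌊ n /2⌋ + ⌈ n /2⌉  ≡⟨ ⌊n/2⌋+⌈n/2⌉≡n n ⟩
  n                  ∎
  where open ≤-Reasoning

<⌊n/2⌋⇒2m+1<n : ∀ {m n} → m < ⌊ n /2⌋ → 2 * m + 1 < n
<⌊n/2⌋⇒2m+1<n {m} {n} m<f = begin-strict
  2 * m + 1          <⟨ n<1+n (2 * m + 1) ⟩
  suc (2 * m + 1)    ≡⟨ cong suc (+-comm (2 * m) 1) ⟩
  2 + 2 * m          ≡⟨ *-suc 2 m ⟨
  2 * suc m          ≤⟨ *-monoʳ-≤ 2 m<f ⟩
  2 * ⌊ n /2⌋        ≡⟨ cong (λ x → ⌊ n /2⌋ + x) (+-identityʳ ⌊ n /2⌋) ⟩
  ⌊ n /2⌋ + ⌊ n /2⌋  ≤⟨ +-monoʳ-≤ ⌊ n /2⌋ (⌊n/2⌋≤⌈n/2⌉ n) ⟩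
  ⌊ n /2⌋ + ⌈ n /2⌉  ≡⟨ ⌊n/2⌋+⌈n/2⌉≡n n ⟩
  n                  ∎
  where open ≤-Reasoning

pos-∸ : ∀ {m n} → n ≤ m → + (m ∸ n) ≡ + m ℤ.- + n
pos-∸ {m} {n} n≤m = sym (trans (ℤ.[+m]-[+n]≡m⊖n m n) (ℤ.⊖-≥ n≤m))

≡r+q*n⇒∣ : ∀ {a b r q q′ n} → a ≡ r + q * n → b ≡ r + q′ * n → + n ∣ + a ℤ.- + b
≡r+q*n⇒∣ {r = r} {q} {q′} {n} refl refl = divides (+ q ℤ.- + q′) (begin
  + (r + q * n) ℤ.- + (r + q′ * n)                  ≡⟨ cong₂ ℤ._-_ (pos-r+q*n q) (pos-r+q*n q′) ⟩
  (+ r ℤ.+ + q ℤ.* + n) ℤ.- (+ r ℤ.+ + q′ ℤ.* + n)  ≡⟨ [r+qn]-[r+q′n]≡[q-q′]n (+ r) (+ q) (+ q′) (+ n) ⟩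
  (+ q ℤ.- + q′) ℤ.* + n                            ∎)
  where
  open ≡-Reasoning
  pos-r+q*n : ∀ q → + (r + q * n) ≡ + r ℤ.+ + q ℤ.* + n
  pos-r+q*n q = trans (ℤ.pos-+ r (q * n)) (cong (λ x → + r ℤ.+ x) (ℤ.pos-* q n))
  [r+qn]-[r+q′n]≡[q-q′]n : ∀ r q q′ n → (r ℤ.+ q ℤ.* n) ℤ.- (r ℤ.+ q′ ℤ.* n) ≡ (q ℤ.- q′) ℤ.* n
  [r+qn]-[r+q′n]≡[q-q′]n = solve-∀

congruent-<⇒≡ : ∀ {n a b} → a < n → b < n → + n ∣ + a ℤ.- + b → a ≡ b
congruent-<⇒≡ {n} {a} {b} a<n b<n n∣a-b with ℤ.∣ + a ℤ.- + b ∣ in ∣a-b∣≡d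
... | zero  = ℤ.+-injective (ℤ.i-j≡0⇒i≡j (+ a) (+ b) (ℤ.∣i∣≡0⇒i≡0 ∣a-b∣≡d))
... | suc d = contradiction (subst (n ∣ℕ_) ∣a-b∣≡d (∣⇒∣ᵤ n∣a-b)) (>⇒∤ d<n)
  where
  d<n : suc d < n
  d<n = begin-strict
    suc d             ≡⟨ ∣a-b∣≡d ⟨
    ℤ.∣ + a ℤ.- + b ∣ ≡⟨ cong ℤ.∣_∣ (ℤ.[+m]-[+n]≡m⊖n a b) ⟩
    ℤ.∣ a ℤ.⊖ b ∣     ≤⟨ ℤ.∣m⊝n∣≤m⊔n a b ⟩
    a ⊔ b             <⟨ ⊔-pres-<m a<n b<n ⟩
    n                 ∎
    where open ≤-Reasoning

[t+x]-[t+y]≡x-y : ∀ t x y → (t ℤ.+ x) ℤ.- (t ℤ.+ y) ≡ x ℤ.- y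
[t+x]-[t+y]≡x-y = solve-∀

∣-flip : ∀ {k} x y → k ∣ x ℤ.- y → k ∣ y ℤ.- x
∣-flip {k} x y k∣x-y = subst (λ z → k ∣ z) (-[x-y]≡y-x x y) (∣m⇒∣-m k∣x-y)
  where
  -[x-y]≡y-x : ∀ x y → ℤ.- (x ℤ.- y) ≡ y ℤ.- x
  -[x-y]≡y-x = solve-∀

δ-δ′∈±1 : ∀ {δ δ′} → δ ≤ 1 → δ′ ≤ 1 →
          let d = + δ ℤ.- + δ′ in d ≡ ℤ.- (+ 1) ⊎ d ≡ + 0 ⊎ d ≡ + 1
δ-δ′∈±1 z≤n       z≤n       = inj₂ (inj₁ refl)
δ-δ′∈±1 z≤n       (s≤s z≤n) = inj₁ refl
δ-δ′∈±1 (s≤s z≤n) z≤n       = inj₂ (inj₂ refl)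
δ-δ′∈±1 (s≤s z≤n) (s≤s z≤n) = inj₂ (inj₁ refl)

2ℓ+δ≡2ℓ′+δ′⇒ℓ≡ℓ′ : ∀ {ℓ ℓ′ δ δ′} → δ ≤ 1 → δ′ ≤ 1 → 2 * ℓ + δ ≡ 2 * ℓ′ + δ′ → ℓ ≡ ℓ′
2ℓ+δ≡2ℓ′+δ′⇒ℓ≡ℓ′ {ℓ} {ℓ′} z≤n z≤n e = *-cancelˡ-≡ ℓ ℓ′ 2 (+-cancelʳ-≡ 0 (2 * ℓ) (2 * ℓ′) e)
2ℓ+δ≡2ℓ′+δ′⇒ℓ≡ℓ′ {ℓ} {ℓ′} (s≤s z≤n) (s≤s z≤n) e = *-cancelˡ-≡ ℓ ℓ′ 2 (+-cancelʳ-≡ 1 (2 * ℓ) (2 * ℓ′) e)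
2ℓ+δ≡2ℓ′+δ′⇒ℓ≡ℓ′ {ℓ} {ℓ′} z≤n (s≤s z≤n) e =
  contradiction (trans (sym (+-identityʳ (2 * ℓ))) (trans e (+-comm (2 * ℓ′) 1))) (even≢odd ℓ ℓ′)
2ℓ+δ≡2ℓ′+δ′⇒ℓ≡ℓ′ {ℓ} {ℓ′} (s≤s z≤n) z≤n e =
  contradiction (trans (sym (+-identityʳ (2 * ℓ′))) (trans (sym e) (+-comm (2 * ℓ) 1))) (even≢odd ℓ′ ℓ)

diag : ℕ → ℕ → ℤ
diag ℓ δ = + 2 ℤ.* + ℓ ℤ.+ + δ

pos-+diag : ∀ a ℓ δ → + (a + 2 * ℓ + δ) ≡ + a ℤ.+ diag ℓ δ
pos-+diag a ℓ δ = begin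
  + (a + 2 * ℓ + δ)            ≡⟨ cong +_ (+-assoc a (2 * ℓ) δ) ⟩
  + (a + (2 * ℓ + δ))          ≡⟨ ℤ.pos-+ a (2 * ℓ + δ) ⟩
  + a ℤ.+ + (2 * ℓ + δ)        ≡⟨ cong (λ x → + a ℤ.+ x) (ℤ.pos-+ (2 * ℓ) δ) ⟩
  + a ℤ.+ (+ (2 * ℓ) ℤ.+ + δ)  ≡⟨ cong (λ x → + a ℤ.+ (x ℤ.+ + δ)) (ℤ.pos-* 2 ℓ) ⟩
  + a ℤ.+ diag ℓ δ             ∎
  where open ≡-Reasoning

diag≡pos : ∀ ℓ δ → diag ℓ δ ≡ + (2 * ℓ + δ)
diag≡pos ℓ δ = sym (trans (pos-+diag 0 ℓ δ) (ℤ.+-identityˡ (diag ℓ δ)))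

swap-offset : ∀ {a b ℓ} δ → ℓ ≤ a → ℓ ≤ b → + (a ∸ ℓ + 2 * ℓ + δ) ℤ.- + (b ∸ ℓ) ≡ (+ a ℤ.- + b) ℤ.+ diag ℓ δ
swap-offset {a} {b} {ℓ} δ ℓ≤a ℓ≤b = begin
  + (a ∸ ℓ + 2 * ℓ + δ) ℤ.- + (b ∸ ℓ)              ≡⟨ cong₂ ℤ._-_ (pos-+diag (a ∸ ℓ) ℓ δ) (pos-∸ ℓ≤b) ⟩
  (+ (a ∸ ℓ) ℤ.+ diag ℓ δ) ℤ.- (+ b ℤ.- + ℓ)        ≡⟨ cong (λ x → (x ℤ.+ diag ℓ δ) ℤ.- (+ b ℤ.- + ℓ)) (pos-∸ ℓ≤a) ⟩
  ((+ a ℤ.- + ℓ) ℤ.+ diag ℓ δ) ℤ.- (+ b ℤ.- + ℓ)    ≡⟨ [a-l+d]-[b-l]≡a-b+d (+ a) (+ b) (+ ℓ) (diag ℓ δ) ⟩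
  (+ a ℤ.- + b) ℤ.+ diag ℓ δ                        ∎
  where
  open ≡-Reasoning
  [a-l+d]-[b-l]≡a-b+d : ∀ a b l d → ((a ℤ.- l) ℤ.+ d) ℤ.- (b ℤ.- l) ≡ (a ℤ.- b) ℤ.+ d
  [a-l+d]-[b-l]≡a-b+d = solve-∀

ind-≟-refl : ∀ a → ind ⌊ a ≟ a ⌋ ≡ 1
ind-≟-refl a with a ≟ a
... | yes _ = refl
... | no a≢a = contradiction refl a≢a

ind-≟≡1⇒≡ : ∀ a b → ind ⌊ a ≟ b ⌋ ≡ 1 → a ≡ b
ind-≟≡1⇒≡ a b _ with a ≟ b
ind-≟≡1⇒≡ a b _  | yes a≡b = a≡b
ind-≟≡1⇒≡ a b () | no _

module _ (n : ℕ) .{{_ : NonZero n}} where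

  coord-row : ∀ i J {k} → k ≤ n → coord n i J k ≡ ind ⌊ k ≟ i ⌋
  coord-row i J {k} k≤n with k ≤? n
  ... | yes _ = refl
  ... | no k≰n = contradiction k≤n k≰n

  coord-column : ∀ i J {m} → 1 ≤ m → m < n → coord n i J (n + m) ≡ ind ⌊ m ≟ J ⌋
  coord-column i J {m} 1≤m m<n with n + m ≤? n | n + m ≤? 2 * n ∸ 1
  ... | yes n+m≤n | _ = contradiction n+m≤n (<⇒≱ (m<m+n n 1≤m))
  ... | no _ | no n+m≰2n∸1 = contradiction n+m≤2n∸1 n+m≰2n∸1
    where
    n+m≤2n∸1 : n + m ≤ 2 * n ∸ 1
    n+m≤2n∸1 = ∸-monoˡ-≤ 1
      (subst (suc (n + m) ≤_) (cong (λ x → n + x) (sym (+-identityʳ n))) (+-monoʳ-< n m<n))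
  ... | no _ | yes _ = cong (λ k → ind ⌊ k ≟ J ⌋) (m+n∸m≡n n m)

  c-coord-≡ : ∀ {i j i′ j′} → c n i j ≡ c n i′ j′ → ∀ {k} → 1 ≤ k → k ≤ 2 * n + 1 →
              coord n i (normJ n j) k ≡ coord n i′ (normJ n j′) k
  c-coord-≡ {i} {j} {i′} {j′} c≡c′ {suc k} _ k<2n+1 = begin
    coord n i (normJ n j) (suc k)                ≡⟨ lookup-c i j ⟨
    lookup (c n i j) (fromℕ< k<2n+1)             ≡⟨ cong (λ v → lookup v (fromℕ< k<2n+1)) c≡c′ ⟩
    lookup (c n i′ j′) (fromℕ< k<2n+1)           ≡⟨ lookup-c i′ j′ ⟩
    coord n i′ (normJ n j′) (suc k)              ∎
    where
    open ≡-Reasoning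
    lookup-c : ∀ i j → lookup (c n i j) (fromℕ< k<2n+1) ≡ coord n i (normJ n j) (suc k)
    lookup-c i j = trans (lookup∘tabulate _ (fromℕ< k<2n+1))
                         (cong (λ x → coord n i (normJ n j) (suc x)) (toℕ-fromℕ< k<2n+1))

  c-injectiveˡ : ∀ {i j i′ j′} → c n i j ≡ c n i′ j′ → 1 ≤ i → i ≤ n → i ≡ i′
  c-injectiveˡ {i} {j} {i′} {j′} c≡c′ 1≤i i≤n = ind-≟≡1⇒≡ i i′ (begin
    ind ⌊ i ≟ i′ ⌋                ≡⟨ coord-row i′ (normJ n j′) i≤n ⟨
    coord n i′ (normJ n j′) i     ≡⟨ c-coord-≡ {i} {j} {i′} {j′} c≡c′ 1≤i i≤2n+1 ⟨
    coord n i (normJ n j) i       ≡⟨ coord-row i (normJ n j) i≤n ⟩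
    ind ⌊ i ≟ i ⌋                 ≡⟨ ind-≟-refl i ⟩
    1                             ∎)
    where
    open ≡-Reasoning
    i≤2n+1 : i ≤ 2 * n + 1
    i≤2n+1 = ≤-trans i≤n (≤-trans (m≤n*m n 2) (m≤m+n (2 * n) 1))

  normJ≤n : ∀ j → normJ n j ≤ n
  normJ≤n j = m%n<n (j ∸ 1) n

  normJ<n⇒c-injectiveʳ : ∀ {i j i′ j′} → c n i j ≡ c n i′ j′ → normJ n j < n → normJ n j ≡ normJ n j′
  normJ<n⇒c-injectiveʳ {i} {j} {i′} {j′} c≡c′ J<n = ind-≟≡1⇒≡ J J′ (begin
    ind ⌊ J ≟ J′ ⌋           ≡⟨ coord-column i′ J′ 1≤J J<n ⟨
    coord n i′ J′ (n + J)    ≡⟨ c-coord-≡ {i} {j} {i′} {j′} c≡c′ 1≤n+J n+J≤2n+1 ⟨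
    coord n i J (n + J)      ≡⟨ coord-column i J 1≤J J<n ⟩
    ind ⌊ J ≟ J ⌋            ≡⟨ ind-≟-refl J ⟩
    1                        ∎)
    where
    open ≡-Reasoning
    J J′ : ℕ
    J = normJ n j
    J′ = normJ n j′
    1≤J : 1 ≤ J
    1≤J = s≤s z≤n
    1≤n+J : 1 ≤ n + J
    1≤n+J = ≤-trans 1≤J (m≤n+m J n)
    n+J≤2n+1 : n + J ≤ 2 * n + 1
    n+J≤2n+1 = ≤-trans (+-monoʳ-≤ n (<⇒≤ J<n))
                 (≤-trans (≤-reflexive (cong (λ x → n + x) (sym (+-identityʳ n)))) (m≤m+n (2 * n) 1))

  -- Column n is the one whose indicator coordinates n+1, …, 2n−1 all vanish, so it is recognised
  -- only by elimination.
  c-injectiveʳ : ∀ {i j i′ j′} → c n i j ≡ c n i′ j′ → normJ n j ≡ normJ n j′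
  c-injectiveʳ {i} {j} {i′} {j′} c≡c′
    with m≤n⇒m<n∨m≡n (normJ≤n j) | m≤n⇒m<n∨m≡n (normJ≤n j′)
  ... | inj₁ J<n | _         = normJ<n⇒c-injectiveʳ {i} {j} {i′} {j′} c≡c′ J<n
  ... | inj₂ _   | inj₁ J′<n = sym (normJ<n⇒c-injectiveʳ {i′} {j′} {i} {j} (sym c≡c′) J′<n)
  ... | inj₂ J≡n | inj₂ J′≡n = trans J≡n (sym J′≡n)

  normJ≡⇒∣ : ∀ {j j′} → 1 ≤ j → 1 ≤ j′ → normJ n j ≡ normJ n j′ → + n ∣ + j ℤ.- + j′
  normJ≡⇒∣ {suc a} {suc b} _ _ J≡J′ = ≡r+q*n⇒∣ {r = normJ n (suc a)} {a / n} {b / n} {n}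
    (cong suc (m≡m%n+[m/n]*n a n))
    (trans (cong suc (m≡m%n+[m/n]*n b n)) (cong (λ r → r + b / n * n) (sym J≡J′)))

  -- A superset of the index pairs of 𝔅_ℓ: the pairs removed from 𝔅̃_ℓ are kept,
  -- since disjointness does not depend on their removal.
  data Index (ℓ i j : ℕ) : Set where
    regular  : ∀ δ → δ ≤ 1 → 1 ≤ i → i ≤ n → j ≡ i + 2 * ℓ + δ → Index ℓ i j
    swapped₁ : ∀ δ → δ ≤ 1 → i ≡ i₁ n ℓ → j ≡ i₂ n ℓ + 2 * ℓ + δ → Index ℓ i j
    swapped₂ : ∀ δ → δ ≤ 1 → i ≡ i₂ n ℓ → j ≡ i₁ n ℓ + 2 * ℓ + δ → Index ℓ i j

  offset : ∀ {ℓ i j} → Index ℓ i j → ℤ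
  offset {ℓ} (regular δ _ _ _ _) = diag ℓ δ
  offset {ℓ} (swapped₁ δ _ _ _)  = (+ n ℤ.- + ⌈ n /2⌉) ℤ.+ diag ℓ δ
  offset {ℓ} (swapped₂ δ _ _ _)  = (+ ⌈ n /2⌉ ℤ.- + n) ℤ.+ diag ℓ δ

  InB⇒Index : ∀ {ℓ v} → InB n ℓ v → ∃₂ λ i j → Index ℓ i j × v ≡ c n i j
  InB⇒Index (inj₁ (inj₁ (i , (1≤i , i≤n) , v≡c) , _)) =
    i , _ , regular 0 z≤n 1≤i i≤n (sym (+-identityʳ _)) , v≡c
  InB⇒Index (inj₁ (inj₂ ((i , (1≤i , i≤n) , v≡c) , _) , _)) =
    i , _ , regular 1 (s≤s z≤n) 1≤i i≤n refl , v≡c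
  InB⇒Index (inj₂ (inj₁ v≡c))                 = _ , _ , swapped₁ 0 z≤n refl (sym (+-identityʳ _)) , v≡c
  InB⇒Index (inj₂ (inj₂ (inj₁ v≡c)))          = _ , _ , swapped₁ 1 (s≤s z≤n) refl refl , v≡c
  InB⇒Index (inj₂ (inj₂ (inj₂ (inj₁ v≡c))))   = _ , _ , swapped₂ 0 z≤n refl (sym (+-identityʳ _)) , v≡c
  InB⇒Index (inj₂ (inj₂ (inj₂ (inj₂ v≡c))))   = _ , _ , swapped₂ 1 (s≤s z≤n) refl refl , v≡c

  module _ {ℓ : ℕ} (ℓ<n/2 : ℓ < ⌊ n /2⌋) where

    ℓ<⌈n/2⌉ : ℓ < ⌈ n /2⌉
    ℓ<⌈n/2⌉ = <⌊n/2⌋⇒<⌈n/2⌉ ℓ<n/2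

    ℓ<n : ℓ < n
    ℓ<n = <-≤-trans ℓ<⌈n/2⌉ (⌈n/2⌉≤n n)

    1≤i₁ : 1 ≤ i₁ n ℓ
    1≤i₁ = subst (1 ≤_) (sym (i₁≡⌈n/2⌉∸ℓ n ℓ)) (m<n⇒0<n∸m ℓ<⌈n/2⌉)

    i₁≤n : i₁ n ℓ ≤ n
    i₁≤n = subst (_≤ n) (sym (i₁≡⌈n/2⌉∸ℓ n ℓ)) (≤-trans (m∸n≤m ⌈ n /2⌉ ℓ) (⌈n/2⌉≤n n))

    1≤i₂ : 1 ≤ i₂ n ℓ
    1≤i₂ = m<n⇒0<n∸m ℓ<n

    index-bounds : ∀ {i j} → Index ℓ i j → 1 ≤ i × i ≤ n
    index-bounds (regular _ _ 1≤i i≤n _) = 1≤i , i≤n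
    index-bounds (swapped₁ _ _ refl _)   = 1≤i₁ , i₁≤n
    index-bounds (swapped₂ _ _ refl _)   = 1≤i₂ , m∸n≤m n ℓ

    index-1≤j : ∀ {i j} → Index ℓ i j → 1 ≤ j
    index-1≤j (regular _ _ 1≤i _ refl) = ≤-trans 1≤i (≤-trans (m≤m+n _ _) (m≤m+n _ _))
    index-1≤j (swapped₁ _ _ _ refl)    = ≤-trans 1≤i₂ (≤-trans (m≤m+n _ _) (m≤m+n _ _))
    index-1≤j (swapped₂ _ _ _ refl)    = ≤-trans 1≤i₁ (≤-trans (m≤m+n _ _) (m≤m+n _ _))

    index-offset : ∀ {i j} (k : Index ℓ i j) → + j ℤ.- + i ≡ offset k
    index-offset {i} (regular δ _ _ _ refl) =
      trans (cong (λ x → x ℤ.- + i) (pos-+diag i ℓ δ)) ([i+d]-i≡d (+ i) (diag ℓ δ))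
      where
      [i+d]-i≡d : ∀ i d → (i ℤ.+ d) ℤ.- i ≡ d
      [i+d]-i≡d = solve-∀
    index-offset (swapped₁ δ _ refl refl) rewrite i₁≡⌈n/2⌉∸ℓ n ℓ =
      swap-offset δ (<⇒≤ ℓ<n) (<⇒≤ ℓ<⌈n/2⌉)
    index-offset (swapped₂ δ _ refl refl) rewrite i₁≡⌈n/2⌉∸ℓ n ℓ =
      swap-offset δ (<⇒≤ ℓ<⌈n/2⌉) (<⇒≤ ℓ<n)

  diag-congruent⇒≡ : ∀ {ℓ ℓ′ δ δ′} → ℓ < ⌊ n /2⌋ → ℓ′ < ⌊ n /2⌋ → δ ≤ 1 → δ′ ≤ 1 →
                     + n ∣ diag ℓ δ ℤ.- diag ℓ′ δ′ → ℓ ≡ ℓ′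
  diag-congruent⇒≡ {ℓ} {ℓ′} {δ} {δ′} ℓ<n/2 ℓ′<n/2 δ≤1 δ′≤1 n∣diag-diag′ =
    2ℓ+δ≡2ℓ′+δ′⇒ℓ≡ℓ′ δ≤1 δ′≤1
      (congruent-<⇒≡ (2ℓ+δ<n ℓ<n/2 δ≤1) (2ℓ+δ<n ℓ′<n/2 δ′≤1)
        (subst (λ x → + n ∣ x) (cong₂ ℤ._-_ (diag≡pos ℓ δ) (diag≡pos ℓ′ δ′)) n∣diag-diag′))
    where
    2ℓ+δ<n : ∀ {ℓ δ} → ℓ < ⌊ n /2⌋ → δ ≤ 1 → 2 * ℓ + δ < n
    2ℓ+δ<n {ℓ} ℓ<n/2 δ≤1 = ≤-<-trans (+-monoʳ-≤ (2 * ℓ) δ≤1) (<⌊n/2⌋⇒2m+1<n ℓ<n/2)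

  c-shared⇒offsets-congruent : ∀ {ℓ ℓ′ i j j′} → ℓ < ⌊ n /2⌋ → ℓ′ < ⌊ n /2⌋ →
    (k : Index ℓ i j) (k′ : Index ℓ′ i j′) → c n i j ≡ c n i j′ → + n ∣ offset k ℤ.- offset k′
  c-shared⇒offsets-congruent {i = i} {j} {j′} ℓ<n/2 ℓ′<n/2 k k′ c≡c′ =
    subst (λ x → + n ∣ x) j-j′≡offset-offset′
      (normJ≡⇒∣ (index-1≤j ℓ<n/2 k) (index-1≤j ℓ′<n/2 k′) (c-injectiveʳ {i} {j} {i} {j′} c≡c′))
    where
    open ≡-Reasoning
    [j-i]-[j′-i]≡j-j′ : ∀ i j j′ → (j ℤ.- i) ℤ.- (j′ ℤ.- i) ≡ j ℤ.- j′
    [j-i]-[j′-i]≡j-j′ = solve-∀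
    j-j′≡offset-offset′ : + j ℤ.- + j′ ≡ offset k ℤ.- offset k′
    j-j′≡offset-offset′ = begin
      + j ℤ.- + j′                            ≡⟨ [j-i]-[j′-i]≡j-j′ (+ i) (+ j) (+ j′) ⟨
      (+ j ℤ.- + i) ℤ.- (+ j′ ℤ.- + i)        ≡⟨ cong₂ ℤ._-_ (index-offset ℓ<n/2 k) (index-offset ℓ′<n/2 k′) ⟩
      offset k ℤ.- offset k′                  ∎

  i₁<i₂ : ∀ {ℓ ℓ′} → ℓ < ⌊ n /2⌋ → ℓ′ < ⌊ n /2⌋ → i₁ n ℓ < i₂ n ℓ′
  i₁<i₂ {ℓ} {ℓ′} ℓ<n/2 ℓ′<n/2 = begin-strict
    i₁ n ℓ         ≡⟨ i₁≡⌈n/2⌉∸ℓ n ℓ ⟩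
    ⌈ n /2⌉ ∸ ℓ    ≤⟨ m∸n≤m ⌈ n /2⌉ ℓ ⟩
    ⌈ n /2⌉        <⟨ m+n≤o⇒m≤o∸n (suc ⌈ n /2⌉) (<⌊n/2⌋⇒⌈n/2⌉+m<n ℓ′<n/2) ⟩
    n ∸ ℓ′         ∎
    where open ≤-Reasoning

module _ (n : ℕ) .{{_ : NonZero n}} (Z : ℕ → Set) (adm : Admissible n Z) where

  Z⇒<⌊n/2⌋ : ∀ {ℓ} → Z ℓ → ℓ < ⌊ n /2⌋
  Z⇒<⌊n/2⌋ {ℓ} zℓ = ≤bigN⇒<⌊n/2⌋ n (proj₁ (proj₁ adm ℓ zℓ)) (proj₂ (proj₁ adm ℓ zℓ))

  ⌈n/2⌉-incongruent : ∀ {ℓ ℓ′ δ δ′} → Z ℓ → Z ℓ′ → δ ≤ 1 → δ′ ≤ 1 →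
    ¬ (+ n ∣ (+ ⌈ n /2⌉ ℤ.- (+ 2 ℤ.* (+ ℓ′ ℤ.- + ℓ) ℤ.+ (+ δ′ ℤ.- + δ))) ℤ.- + n)
  ⌈n/2⌉-incongruent {ℓ} {ℓ′} {δ} {δ′} zℓ zℓ′ δ≤1 δ′≤1 n∣x-n =
    proj₂ adm ℓ′ ℓ (+ δ′ ℤ.- + δ) zℓ′ zℓ (δ-δ′∈±1 δ′≤1 δ≤1)
      (subst (λ h → _≡_[mod_] (+ h) y n) (sym ([n+1∸εn]/2≡⌈n/2⌉ n))
             (∣⇒∣ᵤ (∣m+n∣n⇒∣m {m = + ⌈ n /2⌉ ℤ.- y} n∣x-n (∣m⇒∣-m ∣-refl))))
    where
    y : ℤ
    y = + 2 ℤ.* (+ ℓ′ ℤ.- + ℓ) ℤ.+ (+ δ′ ℤ.- + δ)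

  regular-vs-swapped₁ : ∀ {ℓ ℓ′ δ δ′} → Z ℓ → Z ℓ′ → δ ≤ 1 → δ′ ≤ 1 →
    ¬ (+ n ∣ diag ℓ δ ℤ.- ((+ n ℤ.- + ⌈ n /2⌉) ℤ.+ diag ℓ′ δ′))
  regular-vs-swapped₁ {ℓ} {ℓ′} {δ} {δ′} zℓ zℓ′ δ≤1 δ′≤1 n∣d =
    ⌈n/2⌉-incongruent zℓ zℓ′ δ≤1 δ′≤1
      (subst (λ x → + n ∣ x) (identity (+ n) (+ ⌈ n /2⌉) (+ ℓ) (+ ℓ′) (+ δ) (+ δ′)) n∣d)
    where
    identity : ∀ n h l l′ d d′ → (+ 2 ℤ.* l ℤ.+ d) ℤ.- ((n ℤ.- h) ℤ.+ (+ 2 ℤ.* l′ ℤ.+ d′))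
                                 ≡ (h ℤ.- (+ 2 ℤ.* (l′ ℤ.- l) ℤ.+ (d′ ℤ.- d))) ℤ.- n
    identity = solve-∀

  swapped₂-vs-regular : ∀ {ℓ ℓ′ δ δ′} → Z ℓ → Z ℓ′ → δ ≤ 1 → δ′ ≤ 1 →
    ¬ (+ n ∣ ((+ ⌈ n /2⌉ ℤ.- + n) ℤ.+ diag ℓ δ) ℤ.- diag ℓ′ δ′)
  swapped₂-vs-regular {ℓ} {ℓ′} {δ} {δ′} zℓ zℓ′ δ≤1 δ′≤1 n∣d =
    ⌈n/2⌉-incongruent zℓ zℓ′ δ≤1 δ′≤1
      (subst (λ x → + n ∣ x) (identity (+ n) (+ ⌈ n /2⌉) (+ ℓ) (+ ℓ′) (+ δ) (+ δ′)) n∣d)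
    where
    identity : ∀ n h l l′ d d′ → ((h ℤ.- n) ℤ.+ (+ 2 ℤ.* l ℤ.+ d)) ℤ.- (+ 2 ℤ.* l′ ℤ.+ d′)
                                 ≡ (h ℤ.- (+ 2 ℤ.* (l′ ℤ.- l) ℤ.+ (d′ ℤ.- d))) ℤ.- n
    identity = solve-∀

  offsets-congruent⇒≡ : ∀ {ℓ ℓ′ i j j′} → Z ℓ → Z ℓ′ → (k : Index n ℓ i j) (k′ : Index n ℓ′ i j′) →
                        + n ∣ offset n k ℤ.- offset n k′ → ℓ ≡ ℓ′
  offsets-congruent⇒≡ zℓ zℓ′ (regular _ δ≤1 _ _ _) (regular _ δ′≤1 _ _ _) n∣d =
    diag-congruent⇒≡ n (Z⇒<⌊n/2⌋ zℓ) (Z⇒<⌊n/2⌋ zℓ′) δ≤1 δ′≤1 n∣d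
  offsets-congruent⇒≡ {ℓ} {ℓ′} zℓ zℓ′ (swapped₁ δ δ≤1 _ _) (swapped₁ δ′ δ′≤1 _ _) n∣d =
    diag-congruent⇒≡ n (Z⇒<⌊n/2⌋ zℓ) (Z⇒<⌊n/2⌋ zℓ′) δ≤1 δ′≤1
      (subst (λ x → + n ∣ x) ([t+x]-[t+y]≡x-y (+ n ℤ.- + ⌈ n /2⌉) (diag ℓ δ) (diag ℓ′ δ′)) n∣d)
  offsets-congruent⇒≡ {ℓ} {ℓ′} zℓ zℓ′ (swapped₂ δ δ≤1 _ _) (swapped₂ δ′ δ′≤1 _ _) n∣d =
    diag-congruent⇒≡ n (Z⇒<⌊n/2⌋ zℓ) (Z⇒<⌊n/2⌋ zℓ′) δ≤1 δ′≤1
      (subst (λ x → + n ∣ x) ([t+x]-[t+y]≡x-y (+ ⌈ n /2⌉ ℤ.- + n) (diag ℓ δ) (diag ℓ′ δ′)) n∣d)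
  offsets-congruent⇒≡ zℓ zℓ′ (regular _ δ≤1 _ _ _) (swapped₁ _ δ′≤1 _ _) n∣d =
    ⊥-elim (regular-vs-swapped₁ zℓ zℓ′ δ≤1 δ′≤1 n∣d)
  offsets-congruent⇒≡ zℓ zℓ′ k@(swapped₁ _ δ≤1 _ _) k′@(regular _ δ′≤1 _ _ _) n∣d =
    ⊥-elim (regular-vs-swapped₁ zℓ′ zℓ δ′≤1 δ≤1 (∣-flip (offset n k) (offset n k′) n∣d))
  offsets-congruent⇒≡ zℓ zℓ′ (swapped₂ _ δ≤1 _ _) (regular _ δ′≤1 _ _ _) n∣d =
    ⊥-elim (swapped₂-vs-regular zℓ zℓ′ δ≤1 δ′≤1 n∣d)
  offsets-congruent⇒≡ zℓ zℓ′ k@(regular _ δ≤1 _ _ _) k′@(swapped₂ _ δ′≤1 _ _) n∣d =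
    ⊥-elim (swapped₂-vs-regular zℓ′ zℓ δ′≤1 δ≤1 (∣-flip (offset n k) (offset n k′) n∣d))
  offsets-congruent⇒≡ zℓ zℓ′ (swapped₁ _ _ i≡i₁ _) (swapped₂ _ _ i≡i₂ _) _ =
    ⊥-elim (<-irrefl (trans (sym i≡i₁) i≡i₂) (i₁<i₂ n (Z⇒<⌊n/2⌋ zℓ) (Z⇒<⌊n/2⌋ zℓ′)))
  offsets-congruent⇒≡ zℓ zℓ′ (swapped₂ _ _ i≡i₂ _) (swapped₁ _ _ i≡i₁ _) _ =
    ⊥-elim (<-irrefl (trans (sym i≡i₁) i≡i₂) (i₁<i₂ n (Z⇒<⌊n/2⌋ zℓ′) (Z⇒<⌊n/2⌋ zℓ)))

  c-shared⇒≡ : ∀ {ℓ ℓ′ i j i′ j′} → Z ℓ → Z ℓ′ → Index n ℓ i j → Index n ℓ′ i′ j′ →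
               c n i j ≡ c n i′ j′ → ℓ ≡ ℓ′
  c-shared⇒≡ {i = i} {j} {i′} {j′} zℓ zℓ′ k k′ c≡c′
    with (1≤i , i≤n) ← index-bounds n (Z⇒<⌊n/2⌋ zℓ) k
    with refl ← c-injectiveˡ n {i} {j} {i′} {j′} c≡c′ 1≤i i≤n
    = offsets-congruent⇒≡ zℓ zℓ′ k k′
        (c-shared⇒offsets-congruent n (Z⇒<⌊n/2⌋ zℓ) (Z⇒<⌊n/2⌋ zℓ′) k k′ c≡c′)

lemma6p3 : (n : ℕ) → .{{_ : NonZero n}} → 8 ≤ n → (Z : ℕ → Set) → Admissible n Z →
    ∀ ℓ ℓ′ → Z ℓ → Z ℓ′ → ℓ ≢ ℓ′ →
    ∀ (v : Vec ℕ (2 * n + 1)) → ¬ (InB n ℓ v × InB n ℓ′ v)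
lemma6p3 n _ Z adm ℓ ℓ′ zℓ zℓ′ ℓ≢ℓ′ v (v∈𝔅ℓ , v∈𝔅ℓ′)
  with InB⇒Index n v∈𝔅ℓ | InB⇒Index n v∈𝔅ℓ′
... | _ , _ , k , v≡c | _ , _ , k′ , v≡c′ =
  ℓ≢ℓ′ (c-shared⇒≡ n Z adm zℓ zℓ′ k k′ (trans (sym v≡c) v≡c′))
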